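{- Let $G$ be a finitely generated contracting self-similar group and $S\subseteq G$ a finite generating set closed under restrictions. Then the history graph of the VERS $\mathcal R(G,S)$ coincides with the self-similarity graph $\Sigma(G,S)$: both have vertex set $X^*$ and vertical edges $w\to xw$ ($w\in X^*$, $x\in X$), and for all $n\ge0$, $u,v\in X^n$ and $g\in S$, the history graph has a $g$-colored horizontal edge $u\to v$ if and only if $g(u)=v$.
   Context: Let $X=\{0,1,\dots,d-1\}$, $X^*$ the finite words over $X$, $\varepsilon$ the empty word. A self-similar group is a group $G$ of permutations of $X^*$ such that for every $g\in G$ and $x\in X$ there are $h\in G$, $y\in X$ with $g(xw)=y\,h(w)$ for all $w\in X^*$; write $\sigma_g(x)=y$ and $g_x=h$, and $g_{xw}=(g_x)_w$. $G$ is contracting if there is a finite $N\subseteq G$ such that for each $g\in G$ there is $k$ with $g_w\in N$ for all words $w$ of length $\ge k$. $S$ is closed under restrictions if $g_x\in S$ for all $g\in S$, $x\in X$. The VERS $\mathcal R(G,S)$ produces graphs $\Gamma_n$ with vertex set $X^n$ and edges colored by $S$: $\Gamma_0$ is the vertex $\varepsilon$ with one $g$-colored loop for each $g\in S$; $\Gamma_{n+1}$ has, for every $g'$-colored edge $u\to v$ of $\Gamma_n$ and all $x,y\in X$, $h\in S$ with $\sigma_h(x)=y$ and $h_x=g'$, an $h$-colored edge $xu\to yv$, and no other edges. Its history graph has vertex set $X^*$, vertical edges $w\to xw$, and horizontal edges all edges of all $\Gamma_n$ (with their colors). The self-similarity graph $\Sigma(G,S)$ has vertex set $X^*$, vertical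 edges $w\to xw$ for $w\in X^*$, $x\in X$, and a horizontal edge $u\to g(u)$ labeled $g$ for each $u\in X^*$ and $g\in S$. -}

module Defs where

open import Level using (Level; _⊔_; suc)
open import Data.Nat using (ℕ; zero; _≤_) renaming (suc to 1+)
open import Data.Fin using (Fin)
open import Data.List using (List; []; _∷_; length)
open import Data.List.Relation.Unary.Any using (Any)
open import Data.Product using (Σ; ∃; _×_; _,_)
open import Function.Bundles using (_⇔_)
open import Relation.Binary.PropositionalEquality using (_≡_)
open import Algebra.Bundles using (Group)

Alphabet : ℕ → Set
Alphabet d = Fin d

Word : ℕ → Set
Word d = List (Fin d)

-- A self-similar group over X = Fin d: a group G (stdlib bundle) acting
-- faithfully on X* (so G is a group of permutations of X*: equality in G
-- is exactly equality of the induced maps), with product = composition,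
-- together with the self-similarity data σ_g(x) and restrictions g_x.
record SelfSimilarGroup (d : ℕ) (c ℓ : Level) : Set (suc (c ⊔ ℓ)) where
  field
    group : Group c ℓ
  open Group group public
  field
    act       : Carrier → Word d → Word d
    act-∙     : ∀ g h w → act (g ∙ h) w ≡ act g (act h w)
    act-ε     : ∀ w → act ε w ≡ w
    faithful  : ∀ g h → (g ≈ h) ⇔ (∀ w → act g w ≡ act h w)
    σ         : Carrier → Fin d → Fin d
    res       : Carrier → Fin d → Carrier
    act-∷     : ∀ g x w → act g (x ∷ w) ≡ σ g x ∷ act (res g x) w

  res* : Carrier → Word d → Carrier
  res* g []      = g
  res* g (x ∷ w) = res* (res g x) w

  _∈S_ : Carrier → List Carrier → Set (c ⊔ ℓ)
  g ∈S S = Any (λ h → g ≈ h) S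

  data ⟨_⟩ (S : List Carrier) : Carrier → Set (c ⊔ ℓ) where
    gen  : ∀ {g} → g ∈S S → ⟨ S ⟩ g
    one  : ⟨ S ⟩ ε
    mul  : ∀ {g h} → ⟨ S ⟩ g → ⟨ S ⟩ h → ⟨ S ⟩ (g ∙ h)
    inv  : ∀ {g} → ⟨ S ⟩ g → ⟨ S ⟩ (g ⁻¹)
    resp : ∀ {g h} → g ≈ h → ⟨ S ⟩ g → ⟨ S ⟩ h

  Generates : List Carrier → Set (c ⊔ ℓ)
  Generates S = ∀ g → ⟨ S ⟩ g

  FinitelyGenerated : Set (c ⊔ ℓ)
  FinitelyGenerated = Σ (List Carrier) Generates

  Contracting : Set (c ⊔ ℓ)
  Contracting = Σ (List Carrier) λ N →
    ∀ g → Σ ℕ λ k → ∀ (w : Word d) → k ≤ length w → res* g w ∈S N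

  ClosedUnderRestrictions : List Carrier → Set (c ⊔ ℓ)
  ClosedUnderRestrictions S = ∀ g → g ∈S S → ∀ x → res g x ∈S S

  -- The VERS R(G,S): edges of Γ_n.  Γ n g u v = "a g-colored edge u → v in Γ_n".
  data Γ (S : List Carrier) : ℕ → Carrier → Word d → Word d → Set (c ⊔ ℓ) where
    base : ∀ {g} → g ∈S S → Γ S zero g [] []
    step : ∀ {n g' u v h x y} → Γ S n g' u v → h ∈S S → σ h x ≡ y → res h x ≈ g' →
           Γ S (1+ n) h (x ∷ u) (y ∷ v)

  HistVertical : Word d → Word d → Set
  HistVertical w w' = ∃ λ x → w' ≡ x ∷ w

  HistHorizontal : List Carrier → Carrier → Word d → Word d → Set (c ⊔ ℓ)
  HistHorizontal S g u v = ∃ λ n → Γ S n g u v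

  SSVertical : Word d → Word d → Set
  SSVertical w w' = ∃ λ x → w' ≡ x ∷ w

  SSHorizontal : List Carrier → Carrier → Word d → Word d → Set (c ⊔ ℓ)
  SSHorizontal S g u v = g ∈S S × act g u ≡ v

-- Since h(xu) = σ_h(x) h_x(u), induction on the length of u shows
-- that the g-coloured edges of Γ_n are exactly u → g(u); closure of S under
-- restrictions keeps every colour met along the way inside S.
module Submission where

open import Defs
open import Level using (Level)
open import Data.Nat using (ℕ)
open import Data.List using (List; length; []; _∷_)
open import Data.Product using (_×_; _,_)
open import Function.Base using (id)
open import Function.Bundles using (_⇔_; mk⇔; Equivalence)
open import Relation.Nullary using (contradiction)
open import Relation.Binary.PropositionalEquality
  using (_≡_; refl; trans; cong; cong₂; module ≡-Reasoning)

module _ {d : ℕ} {c ℓ : Level} (G : SelfSimilarGroup d c ℓ) where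
  open SelfSimilarGroup G hiding (sym; trans) renaming (refl to ≈-refl)

  act-cong : ∀ {g h} → g ≈ h → ∀ w → act g w ≡ act h w
  act-cong = Equivalence.to (faithful _ _)

  -- g⁻¹ undoes g, and no element maps a non-empty word to [].
  act-[] : ∀ g → act g [] ≡ []
  act-[] g with act g [] in eq
  ... | []    = refl
  ... | x ∷ w = contradiction (begin
      σ (g ⁻¹) x ∷ act (res (g ⁻¹) x) w ≡⟨ act-∷ (g ⁻¹) x w ⟨
      act (g ⁻¹) (x ∷ w)                ≡⟨ cong (act (g ⁻¹)) eq ⟨
      act (g ⁻¹) (act g [])             ≡⟨ act-∙ (g ⁻¹) g [] ⟨
      act (g ⁻¹ ∙ g) []                 ≡⟨ act-cong (inverseˡ g) [] ⟩
      act ε []                          ≡⟨ act-ε [] ⟩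
      []                                ∎) λ ()
    where open ≡-Reasoning

  Γ⇒act : ∀ {S n g u v} → Γ S n g u v → act g u ≡ v
  Γ⇒act (base _) = act-[] _
  Γ⇒act {g = h} {u = x ∷ u} {y ∷ v} (step γ _ σ≡ res≈) = begin
    act h (x ∷ u)           ≡⟨ act-∷ h x u ⟩
    σ h x ∷ act (res h x) u ≡⟨ cong₂ _∷_ σ≡ (trans (act-cong res≈ u) (Γ⇒act γ)) ⟩
    y ∷ v                   ∎
    where open ≡-Reasoning

  act⇒Γ : ∀ {S} → ClosedUnderRestrictions S →
          ∀ {g} → g ∈S S → ∀ u → Γ S (length u) g u (act g u)
  act⇒Γ closed {g} g∈S [] rewrite act-[] g = base g∈S
  act⇒Γ closed {g} g∈S (x ∷ u) rewrite act-∷ g x u =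
    step (act⇒Γ closed (closed g g∈S x) u) g∈S refl ≈-refl

theorem4p3 : ∀ {d : ℕ} {c ℓ : Level} (G : SelfSimilarGroup d c ℓ) →
    let open SelfSimilarGroup G in
    FinitelyGenerated → Contracting →
    (S : List Carrier) → Generates S → ClosedUnderRestrictions S →
    (∀ w w' → HistVertical w w' ⇔ SSVertical w w') ×
    (∀ (n : ℕ) (u v : Word d) → length u ≡ n → length v ≡ n →
    ∀ g → g ∈S S → (HistHorizontal S g u v ⇔ act g u ≡ v))
theorem4p3 G _ _ S _ closed =
  (λ _ _ → mk⇔ id id) ,
  λ _ u _ _ _ g g∈S → mk⇔
    (λ { (_ , γ) → Γ⇒act G γ })
    (λ { refl → length u , act⇒Γ G closed g∈S u })
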